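{- Let $L$ and $R$ be nonempty subsets of a group $G$ such that $\mathcal{W}(L)$ and $\mathcal{W}(R)$ are subgroups of $G$, and let $s\in G$. If $k_s$ is the minimum strong connection length in $\langle L\rangle s\langle R\rangle$ in $2\mathrm{S}(G;L,R)$, then the double coset $\langle L\rangle s\langle R\rangle$ consists of exactly $k_s$ strongly connected components (infinitely many if $k_s$ is infinite), all of the same size. Moreover, if $L\cap N_G(L)\neq\emptyset$ or $R\cap N_G(R)\neq\emptyset$, then all strongly connected components within the same double coset are isomorphic as digraphs.
   Context: For a group $G$ and nonempty subsets $L,R\subseteq G$, the two-sided group digraph $2\mathrm{S}(G;L,R)$ has vertex set $G$ and a directed arc $(g,h)$ if and only if $h=l^{ -1}gr$ for some $l\in L$, $r\in R$. Vertices $g,h$ are strongly connected if there are directed paths from $g$ to $h$ and from $h$ to $g$; strongly connected components are the classes of this equivalence relation. A word in a nonempty set $S$ of length $n>0$ is a product $s_1\cdots s_n$ with all $s_i\in S$; $\mathcal{W}(S)$ is the set of elements of $G$ given by words in $S$ of finite positive length; $L^{ -1}=\{l^{ -1}:l\in L\}$; $\langle X\rangle$ is the subgroup generated by $X$. The minimum strong connection length in $\langle L\rangle s\langle R\rangle$ is the minimum length $k_s\ge 1$ of a word $w$ purely in $L$ or purely in $L^{ -1}$ such that $ws$ is strongly connected to $s$ in $2\mathrm{S}(G;L,R)$ (equivalently, the minimum length of a word $w$ purely in $R$ or purely in $R^{ -1}$ with $sw$ strongly connected to $s$), and is infinite if no such word exists. For $X\subseteq G$, $N_G(X)=\{g\in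 G: gXg^{ -1}=X\}$. -}

module Defs where

open import Level using (Level; _⊔_)
open import Algebra.Bundles using (Group)
open import Data.Nat using (ℕ; zero; suc; _≤_; _<_)
open import Data.Fin using (Fin)
open import Data.Product using (Σ; ∃; _×_; _,_; proj₁; proj₂)
open import Data.Sum using (_⊎_)
open import Relation.Nullary using (¬_)
open import Relation.Unary using (Pred)
open import Relation.Binary.PropositionalEquality using (_≡_)

module GroupDigraph {c ℓ : Level} (G : Group c ℓ) where
  open Group G

  Respects≈ : ∀ {p} → Pred Carrier p → Set (c ⊔ ℓ ⊔ p)
  Respects≈ S = ∀ {x y} → x ≈ y → S x → S y

  NonEmpty : ∀ {p} → Pred Carrier p → Set (c ⊔ p)
  NonEmpty S = ∃ λ x → S x

  Inv : ∀ {p} → Pred Carrier p → Pred Carrier (c ⊔ ℓ ⊔ p)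
  Inv S x = ∃ λ s → S s × x ≈ s ⁻¹

  data Word {p} (S : Pred Carrier p) : ℕ → Carrier → Set (c ⊔ p) where
    [_]  : ∀ {s} → S s → Word S 1 s
    _∷_ : ∀ {s n w} → S s → Word S n w → Word S (suc n) (s ∙ w)

  𝒲 : ∀ {p} → Pred Carrier p → Pred Carrier (c ⊔ ℓ ⊔ p)
  𝒲 S g = ∃ λ n → ∃ λ w → Word S n w × g ≈ w

  IsSubgroup : ∀ {p} → Pred Carrier p → Set (c ⊔ p)
  IsSubgroup H = H ε × (∀ {x y} → H x → H y → H (x ∙ y)) × (∀ {x} → H x → H (x ⁻¹))

  data ⟨_⟩ {p} (X : Pred Carrier p) : Carrier → Set (c ⊔ ℓ ⊔ p) where
    gen  : ∀ {x} → X x → ⟨ X ⟩ x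
    unit : ⟨ X ⟩ ε
    mul  : ∀ {x y} → ⟨ X ⟩ x → ⟨ X ⟩ y → ⟨ X ⟩ (x ∙ y)
    inv  : ∀ {x} → ⟨ X ⟩ x → ⟨ X ⟩ (x ⁻¹)
    resp : ∀ {x y} → x ≈ y → ⟨ X ⟩ x → ⟨ X ⟩ y

  Normalizer : ∀ {p} → Pred Carrier p → Pred Carrier (c ⊔ ℓ ⊔ p)
  Normalizer X g =
    (∀ x → X x → X ((g ∙ x) ∙ g ⁻¹)) ×
    (∀ y → X y → ∃ λ x → X x × y ≈ (g ∙ x) ∙ g ⁻¹)

  module TwoSided {p} (L R : Pred Carrier p) where

    Arc : Carrier → Carrier → Set (c ⊔ ℓ ⊔ p)
    Arc g h = ∃ λ l → ∃ λ r → L l × R r × h ≈ (l ⁻¹ ∙ g) ∙ r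

    data Reach : Carrier → Carrier → Set (c ⊔ ℓ ⊔ p) where
      here : ∀ {g h} → g ≈ h → Reach g h
      step : ∀ {g h k} → Arc g h → Reach h k → Reach g k

    StronglyConnected : Carrier → Carrier → Set (c ⊔ ℓ ⊔ p)
    StronglyConnected g h = Reach g h × Reach h g

    DoubleCoset : Carrier → Pred Carrier (c ⊔ ℓ ⊔ p)
    DoubleCoset s g = ∃ λ a → ∃ λ b → ⟨ L ⟩ a × ⟨ R ⟩ b × g ≈ (a ∙ s) ∙ b

    HasConnWord : Carrier → ℕ → Set (c ⊔ ℓ ⊔ p)
    HasConnWord s n =
      ∃ λ w → (Word L n w ⊎ Word (Inv L) n w) × StronglyConnected (w ∙ s) s

    IsMinConnLength : Carrier → ℕ → Set (c ⊔ ℓ ⊔ p)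
    IsMinConnLength s k =
      1 ≤ k × HasConnWord s k × (∀ m → 1 ≤ m → m < k → ¬ HasConnWord s m)

    InfiniteConnLength : Carrier → Set (c ⊔ ℓ ⊔ p)
    InfiniteConnLength s = ∀ n → 1 ≤ n → ¬ HasConnWord s n

    ExactlyComponents : Carrier → ℕ → Set (c ⊔ ℓ ⊔ p)
    ExactlyComponents s k =
      Σ (Fin k → Carrier) λ rep →
        (∀ i → DoubleCoset s (rep i)) ×
        (∀ g → DoubleCoset s g → ∃ λ i → StronglyConnected g (rep i)) ×
        (∀ i j → StronglyConnected (rep i) (rep j) → i ≡ j)

    InfinitelyManyComponents : Carrier → Set (c ⊔ ℓ ⊔ p)
    InfinitelyManyComponents s =
      Σ (ℕ → Carrier) λ rep →
        (∀ i → DoubleCoset s (rep i)) ×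
        (∀ i j → StronglyConnected (rep i) (rep j) → i ≡ j)

    Comp : Carrier → Set (c ⊔ ℓ ⊔ p)
    Comp x = Σ Carrier (StronglyConnected x)

    record CompBijection (x y : Carrier) : Set (c ⊔ ℓ ⊔ p) where
      field
        to       : Comp x → Comp y
        from     : Comp y → Comp x
        to-cong  : ∀ a b → proj₁ a ≈ proj₁ b → proj₁ (to a) ≈ proj₁ (to b)
        from-cong : ∀ a b → proj₁ a ≈ proj₁ b → proj₁ (from a) ≈ proj₁ (from b)
        to-from  : ∀ b → proj₁ (to (from b)) ≈ proj₁ b
        from-to  : ∀ a → proj₁ (from (to a)) ≈ proj₁ a

    SameSize : Carrier → Carrier → Set (c ⊔ ℓ ⊔ p)
    SameSize x y = CompBijection x y

    ComponentsIsomorphic : Carrier → Carrier → Set (c ⊔ ℓ ⊔ p)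
    ComponentsIsomorphic x y =
      Σ (CompBijection x y) λ f →
        ∀ a b → (Arc (proj₁ a) (proj₁ b) → Arc (proj₁ (CompBijection.to f a)) (proj₁ (CompBijection.to f b)))
              × (Arc (proj₁ (CompBijection.to f a)) (proj₁ (CompBijection.to f b)) → Arc (proj₁ a) (proj₁ b))

module Submission where

-- A path of length n maps g to a⁻¹ g b with a (b) a product of n letters of L
-- (of R); call (a , b) balanced.  Since 𝒲(L), 𝒲(R) are subgroups, elements of
-- ⟨L⟩, ⟨R⟩ have spellings of positive length, and balanced pairs form a subgroup
-- of G × G normalised by ⟨L⟩ × ⟨R⟩.  So g ~ h, "h = a⁻¹ g b for a balanced pair",
-- is an equivalence that equals reachability and strong connectivity and is
-- invariant under translations g ↦ u g v (u ∈ ⟨L⟩, v ∈ ⟨R⟩).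

open import Defs
open import Level using (Level; _⊔_)
open import Algebra.Bundles using (Group)
import Algebra.Properties.Group as GroupProperties
import Algebra.Properties.Monoid.Mult as MonoidMultiplication
open import Data.Nat using (ℕ; zero; suc; _+_; _*_; _≤_; _<_; s≤s; z≤n)
open import Data.Nat.Properties using (*-comm; +-identityʳ; +-suc; +-comm; <-cmp; ≤-trans; m≤n+m; m≤n⇒∃[o]m+o≡n)
open import Data.Nat.DivMod using (_%_; _/_; m≡m%n+[m/n]*n; m%n<n)
open import Data.Nat.Tactic.RingSolver using (solve-∀)
open import Data.Fin using (Fin; toℕ; fromℕ<)
open import Data.Fin.Properties using (toℕ-injective; toℕ-fromℕ<; toℕ<n)
open import Data.Empty using (⊥-elim)
open import Data.Product using (∃; _×_; _,_; proj₁; proj₂)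
open import Data.Sum using (_⊎_; inj₁; inj₂)
open import Relation.Nullary using (¬_)
open import Relation.Unary using (Pred)
open import Relation.Binary.Definitions using (tri<; tri≈; tri>)
open import Relation.Binary.PropositionalEquality as ≡ using (_≡_)
import Relation.Binary.Reasoning.Setoid as SetoidReasoning
open import Tactic.MonoidSolver using (solve)

-- Word lengths that make the spellings of a⁻¹ and b⁻¹ agree (balanced-inverse).
inverse-lengths : ∀ n m m' → suc m + (n + m') * (n + suc m) ≡ suc m' + (n + m) * (n + suc m')
inverse-lengths = solve-∀

-- The spellings of u c u⁻¹ c⁻¹ and u c c⁻¹ u⁻¹ have the same length (balanced-conj).
swap-last : ∀ a b c d → ((a + b) + c) + d ≡ ((a + b) + d) + c
swap-last = solve-∀

-- One more period k in the exponent of l (shift).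
add-period : ∀ a q k → a + (k + q * k) ≡ (a + q * k) + k
add-period = solve-∀

module TwoSidedComponents {c ℓ p : Level} (G : Group c ℓ) where
  open Group G
  open GroupProperties G
    using (ε⁻¹≈ε; ⁻¹-involutive; ⁻¹-anti-homo-∙; \\-leftDividesˡ; \\-leftDividesʳ; //-rightDividesˡ; //-rightDividesʳ)
  open MonoidMultiplication monoid using (×-congʳ; ×-homo-+) renaming (_×_ to _times_)
  open GroupDigraph G
  open SetoidReasoning setoid

  infixr 8 _^_
  _^_ : Carrier → ℕ → Carrier
  x ^ n = n times x

  ^-+ : ∀ x m n → x ^ (m + n) ≈ x ^ m ∙ x ^ n
  ^-+ = ×-homo-+

  ε^n≈ε : ∀ n → ε ^ n ≈ ε
  ε^n≈ε zero    = refl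
  ε^n≈ε (suc n) = trans (∙-congˡ (ε^n≈ε n)) (identityˡ ε)

  ^-commute : ∀ x n → x ^ n ∙ x ≈ x ∙ x ^ n
  ^-commute x zero    = trans (identityˡ x) (sym (identityʳ x))
  ^-commute x (suc n) = trans (assoc x (x ^ n) x) (∙-congˡ (^-commute x n))

  act : Carrier → Carrier → Carrier → Carrier
  act a b g = (a ⁻¹ ∙ g) ∙ b

  translate : Carrier → Carrier → Carrier → Carrier
  translate u v g = (u ∙ g) ∙ v

  act-cong : ∀ {a a' b b' g g'} → a ≈ a' → b ≈ b' → g ≈ g' → act a b g ≈ act a' b' g'
  act-cong ea eb eg = ∙-cong (∙-cong (⁻¹-cong ea) eg) eb

  translate-cong : ∀ {u u' v v' g g'} → u ≈ u' → v ≈ v' → g ≈ g' → translate u v g ≈ translate u' v' g'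
  translate-cong eu ev eg = ∙-cong (∙-cong eu eg) ev

  act-ε : ∀ g → act ε ε g ≈ g
  act-ε g = begin
    (ε ⁻¹ ∙ g) ∙ ε ≈⟨ identityʳ _ ⟩
    ε ⁻¹ ∙ g       ≈⟨ ∙-congʳ ε⁻¹≈ε ⟩
    ε ∙ g          ≈⟨ identityˡ g ⟩
    g              ∎

  act-∙ : ∀ a a' b b' g → act (a ∙ a') (b ∙ b') g ≈ act a' b' (act a b g)
  act-∙ a a' b b' g = begin
    ((a ∙ a') ⁻¹ ∙ g) ∙ (b ∙ b')      ≈⟨ ∙-congʳ (∙-congʳ (⁻¹-anti-homo-∙ a a')) ⟩
    ((a' ⁻¹ ∙ a ⁻¹) ∙ g) ∙ (b ∙ b')   ≈⟨ solve monoid ⟩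
    (a' ⁻¹ ∙ ((a ⁻¹ ∙ g) ∙ b)) ∙ b'   ∎

  act-⁻¹ : ∀ a b g → act (a ⁻¹) (b ⁻¹) (act a b g) ≈ g
  act-⁻¹ a b g = begin
    ((a ⁻¹) ⁻¹ ∙ ((a ⁻¹ ∙ g) ∙ b)) ∙ b ⁻¹  ≈⟨ ∙-congʳ (∙-congʳ (⁻¹-involutive a)) ⟩
    (a ∙ ((a ⁻¹ ∙ g) ∙ b)) ∙ b ⁻¹         ≈⟨ solve monoid ⟩
    ((a ∙ (a ⁻¹ ∙ g)) ∙ b) ∙ b ⁻¹         ≈⟨ //-rightDividesʳ b _ ⟩
    a ∙ (a ⁻¹ ∙ g)                        ≈⟨ \\-leftDividesˡ a g ⟩
    g                                     ∎

  conj-⁻¹ : ∀ u a → ((u ∙ a) ∙ u ⁻¹) ⁻¹ ≈ (u ∙ a ⁻¹) ∙ u ⁻¹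
  conj-⁻¹ u a = begin
    ((u ∙ a) ∙ u ⁻¹) ⁻¹     ≈⟨ ⁻¹-anti-homo-∙ _ _ ⟩
    (u ⁻¹) ⁻¹ ∙ (u ∙ a) ⁻¹  ≈⟨ ∙-cong (⁻¹-involutive u) (⁻¹-anti-homo-∙ u a) ⟩
    u ∙ (a ⁻¹ ∙ u ⁻¹)       ≈⟨ solve monoid ⟩
    (u ∙ a ⁻¹) ∙ u ⁻¹       ∎

  translate-act : ∀ u v a b g →
    act ((u ∙ a) ∙ u ⁻¹) ((v ⁻¹ ∙ b) ∙ v) (translate u v g) ≈ translate u v (act a b g)
  translate-act u v a b g = begin
    (((u ∙ a) ∙ u ⁻¹) ⁻¹ ∙ ((u ∙ g) ∙ v)) ∙ ((v ⁻¹ ∙ b) ∙ v)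
      ≈⟨ ∙-congʳ (∙-congʳ (conj-⁻¹ u a)) ⟩
    (((u ∙ a ⁻¹) ∙ u ⁻¹) ∙ ((u ∙ g) ∙ v)) ∙ ((v ⁻¹ ∙ b) ∙ v)
      ≈⟨ solve monoid ⟩
    (u ∙ a ⁻¹) ∙ (u ⁻¹ ∙ (u ∙ (g ∙ (v ∙ (v ⁻¹ ∙ (b ∙ v))))))
      ≈⟨ ∙-congˡ (\\-leftDividesʳ u _) ⟩
    (u ∙ a ⁻¹) ∙ (g ∙ (v ∙ (v ⁻¹ ∙ (b ∙ v))))
      ≈⟨ ∙-congˡ (∙-congˡ (\\-leftDividesˡ v _)) ⟩
    (u ∙ a ⁻¹) ∙ (g ∙ (b ∙ v))
      ≈⟨ solve monoid ⟩
    (u ∙ ((a ⁻¹ ∙ g) ∙ b)) ∙ v ∎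

  translate-⁻¹ : ∀ u v g → translate (u ⁻¹) (v ⁻¹) (translate u v g) ≈ g
  translate-⁻¹ u v g = begin
    (u ⁻¹ ∙ ((u ∙ g) ∙ v)) ∙ v ⁻¹  ≈⟨ solve monoid ⟩
    (u ⁻¹ ∙ (u ∙ g)) ∙ (v ∙ v ⁻¹)  ≈⟨ ∙-cong (\\-leftDividesʳ u g) (inverseʳ v) ⟩
    g ∙ ε                          ≈⟨ identityʳ g ⟩
    g                              ∎

  translate-⁻¹′ : ∀ u v g → translate u v (translate (u ⁻¹) (v ⁻¹) g) ≈ g
  translate-⁻¹′ u v g = begin
    (u ∙ ((u ⁻¹ ∙ g) ∙ v ⁻¹)) ∙ v  ≈⟨ solve monoid ⟩
    (u ∙ (u ⁻¹ ∙ g)) ∙ (v ⁻¹ ∙ v)  ≈⟨ ∙-cong (\\-leftDividesˡ u g) (inverseˡ v) ⟩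
    g ∙ ε                          ≈⟨ identityʳ g ⟩
    g                              ∎

  translate-injective : ∀ {u v g h} → translate u v g ≈ translate u v h → g ≈ h
  translate-injective {u} {v} {g} {h} e = begin
    g                                          ≈⟨ translate-⁻¹ u v g ⟨
    translate (u ⁻¹) (v ⁻¹) (translate u v g)  ≈⟨ translate-cong refl refl e ⟩
    translate (u ⁻¹) (v ⁻¹) (translate u v h)  ≈⟨ translate-⁻¹ u v h ⟩
    h                                          ∎

  translate-∘ : ∀ u v u' v' g → translate u' v' (translate u v g) ≈ translate (u' ∙ u) (v ∙ v') g
  translate-∘ u v u' v' g = solve monoid

  conj-ε : ∀ x → (ε ∙ x) ∙ ε ⁻¹ ≈ x
  conj-ε x = trans (∙-congˡ ε⁻¹≈ε) (trans (identityʳ _) (identityˡ x))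

  conj-ε⁻¹ : ∀ x → (ε ⁻¹ ∙ x) ∙ ε ≈ x
  conj-ε⁻¹ x = trans (identityʳ _) (trans (∙-congʳ ε⁻¹≈ε) (identityˡ x))

  conj-cancel : ∀ v x → (v ⁻¹ ∙ ((v ∙ x) ∙ v ⁻¹)) ∙ v ≈ x
  conj-cancel v x =
    trans (translate-cong refl (sym (⁻¹-involutive v)) refl) (translate-⁻¹ v (v ⁻¹) x)

  act-absorbˡ : ∀ w a b x → act w (b ⁻¹) (translate a b x) ≈ (w ⁻¹ ∙ a) ∙ x
  act-absorbˡ w a b x = begin
    (w ⁻¹ ∙ ((a ∙ x) ∙ b)) ∙ b ⁻¹  ≈⟨ solve monoid ⟩
    ((w ⁻¹ ∙ a) ∙ x) ∙ (b ∙ b ⁻¹)  ≈⟨ ∙-congˡ (inverseʳ b) ⟩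
    ((w ⁻¹ ∙ a) ∙ x) ∙ ε           ≈⟨ identityʳ _ ⟩
    (w ⁻¹ ∙ a) ∙ x                 ∎

  act-absorbʳ : ∀ w a b x → act a w (translate a b x) ≈ x ∙ (b ∙ w)
  act-absorbʳ w a b x = begin
    (a ⁻¹ ∙ ((a ∙ x) ∙ b)) ∙ w  ≈⟨ solve monoid ⟩
    (a ⁻¹ ∙ a) ∙ (x ∙ (b ∙ w))  ≈⟨ ∙-congʳ (inverseˡ a) ⟩
    ε ∙ (x ∙ (b ∙ w))           ≈⟨ identityˡ _ ⟩
    x ∙ (b ∙ w)                 ∎

  act-replaceˡ : ∀ u u' x → act (u' ∙ u ⁻¹) ε (u' ∙ x) ≈ u ∙ x
  act-replaceˡ u u' x = begin
    ((u' ∙ u ⁻¹) ⁻¹ ∙ (u' ∙ x)) ∙ ε       ≈⟨ ∙-congʳ (∙-congʳ (⁻¹-anti-homo-∙ u' (u ⁻¹))) ⟩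
    (((u ⁻¹) ⁻¹ ∙ u' ⁻¹) ∙ (u' ∙ x)) ∙ ε  ≈⟨ solve monoid ⟩
    (u ⁻¹) ⁻¹ ∙ (u' ⁻¹ ∙ (u' ∙ x))       ≈⟨ ∙-cong (⁻¹-involutive u) (\\-leftDividesʳ u' x) ⟩
    u ∙ x                                ∎

  act-replaceʳ : ∀ v v' x → act ε (v' ⁻¹ ∙ v) (x ∙ v') ≈ x ∙ v
  act-replaceʳ v v' x = begin
    (ε ⁻¹ ∙ (x ∙ v')) ∙ (v' ⁻¹ ∙ v)  ≈⟨ ∙-congʳ (∙-congʳ ε⁻¹≈ε) ⟩
    (ε ∙ (x ∙ v')) ∙ (v' ⁻¹ ∙ v)     ≈⟨ solve monoid ⟩
    x ∙ (v' ∙ (v' ⁻¹ ∙ v))           ≈⟨ ∙-congˡ (\\-leftDividesˡ v' v) ⟩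
    x ∙ v                            ∎

  -- Spelled S n x: x is a product of n letters of S (n = 0 allowed), up to ≈.
  -- Unlike Word, spellings may be empty, which makes concatenation total.

  infixr 5 _∷ˢ_
  data Spelled (S : Pred Carrier p) : ℕ → Carrier → Set (c ⊔ ℓ ⊔ p) where
    []ˢ   : Spelled S 0 ε
    _∷ˢ_  : ∀ {s n w} → S s → Spelled S n w → Spelled S (suc n) (s ∙ w)
    respˢ : ∀ {n x y} → x ≈ y → Spelled S n x → Spelled S n y

  module _ {S : Pred Carrier p} where
    infixr 5 _++ˢ_

    letterˢ : ∀ {s} → S s → Spelled S 1 s
    letterˢ Ss = respˢ (identityʳ _) (Ss ∷ˢ []ˢ)

    _++ˢ_ : ∀ {m n a b} → Spelled S m a → Spelled S n b → Spelled S (m + n) (a ∙ b)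
    []ˢ         ++ˢ sb = respˢ (sym (identityˡ _)) sb
    (Ss ∷ˢ sa)  ++ˢ sb = respˢ (sym (assoc _ _ _)) (Ss ∷ˢ (sa ++ˢ sb))
    respˢ e sa  ++ˢ sb = respˢ (∙-congʳ e) (sa ++ˢ sb)

    powerˢ : ∀ {n x} → Spelled S n x → ∀ j → Spelled S (j * n) (x ^ j)
    powerˢ sx zero    = []ˢ
    powerˢ sx (suc j) = sx ++ˢ powerˢ sx j

    letter-powerˢ : ∀ {s} → S s → ∀ j → Spelled S j (s ^ j)
    letter-powerˢ Ss zero    = []ˢ
    letter-powerˢ Ss (suc j) = Ss ∷ˢ letter-powerˢ Ss j

    padˢ : ∀ {A B x e} → Spelled S A x → Spelled S B e → e ≈ ε → ∀ q → Spelled S (A + q * B) x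
    padˢ sx se e≈ε q =
      respˢ (trans (∙-congˡ (trans (×-congʳ q e≈ε) (ε^n≈ε q))) (identityʳ _)) (sx ++ˢ powerˢ se q)

    unconsˢ : ∀ {n x} → Spelled S (suc n) x → ∃ λ s → ∃ λ w → S s × Spelled S n w × x ≈ s ∙ w
    unconsˢ (Ss ∷ˢ sw) = _ , _ , Ss , sw , refl
    unconsˢ (respˢ e sx) =
      let s , w , Ss , sw , x≈sw = unconsˢ sx in s , w , Ss , sw , trans (sym e) x≈sw

    empty-spelling : ∀ {x} → Spelled S 0 x → x ≈ ε
    empty-spelling []ˢ          = refl
    empty-spelling (respˢ e sx) = trans (sym e) (empty-spelling sx)

    spelled⇒⟨⟩ : ∀ {n x} → Spelled S n x → ⟨ S ⟩ x
    spelled⇒⟨⟩ []ˢ          = unit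
    spelled⇒⟨⟩ (Ss ∷ˢ sx)   = mul (gen Ss) (spelled⇒⟨⟩ sx)
    spelled⇒⟨⟩ (respˢ e sx) = resp e (spelled⇒⟨⟩ sx)

    word⇒spelled : ∀ {n w} → Word S n w → Spelled S n w
    word⇒spelled [ Ss ]    = letterˢ Ss
    word⇒spelled (Ss ∷ ws) = Ss ∷ˢ word⇒spelled ws

    inverse-word⇒spelled : ∀ {n w} → Word (Inv S) n w → Spelled S n (w ⁻¹)
    inverse-word⇒spelled [ s , Ss , e ] =
      respˢ (sym (trans (⁻¹-cong e) (⁻¹-involutive s))) (letterˢ Ss)
    inverse-word⇒spelled (_∷_ {x} {n} {w} (s , Ss , e) ws) =
      respˢ (sym (trans (⁻¹-anti-homo-∙ x w) (∙-congˡ (trans (⁻¹-cong e) (⁻¹-involutive s)))))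
            (≡.subst (λ m → Spelled S m (w ⁻¹ ∙ s)) (+-comm n 1) (inverse-word⇒spelled ws ++ˢ letterˢ Ss))

    word-length-positive : ∀ {n w} → Word S n w → 1 ≤ n
    word-length-positive [ _ ]   = s≤s z≤n
    word-length-positive (_ ∷ _) = s≤s z≤n

    letter-power-word : ∀ {s} → S s → ∀ n → ∃ λ w → Word S (suc n) w × w ≈ s ^ suc n
    letter-power-word Ss zero    = _ , [ Ss ] , sym (identityʳ _)
    letter-power-word Ss (suc n) =
      let w , ws , w≈ = letter-power-word Ss n in _ , Ss ∷ ws , ∙-congˡ w≈

  -- When 𝒲(S) is a subgroup, ⟨S⟩ = 𝒲(S), so every element of ⟨S⟩ (in particular ε and
  -- every inverse of a spelled element) has a spelling of positive length.

  module PositiveSpellings {S : Pred Carrier p} (𝒲S-subgroup : IsSubgroup (𝒲 S)) where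
    private
      𝒲-ε   = proj₁ 𝒲S-subgroup
      𝒲-∙   = proj₁ (proj₂ 𝒲S-subgroup)
      𝒲-⁻¹  = proj₂ (proj₂ 𝒲S-subgroup)

    ⟨⟩⇒𝒲 : ∀ {x} → ⟨ S ⟩ x → 𝒲 S x
    ⟨⟩⇒𝒲 (gen Ss)    = 1 , _ , [ Ss ] , refl
    ⟨⟩⇒𝒲 unit        = 𝒲-ε
    ⟨⟩⇒𝒲 (mul gx gy) = 𝒲-∙ (⟨⟩⇒𝒲 gx) (⟨⟩⇒𝒲 gy)
    ⟨⟩⇒𝒲 (inv gx)    = 𝒲-⁻¹ (⟨⟩⇒𝒲 gx)
    ⟨⟩⇒𝒲 (resp e gx) = let n , w , ws , x≈w = ⟨⟩⇒𝒲 gx in n , w , ws , trans (sym e) x≈w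

    𝒲⇒spelled : ∀ {x} → 𝒲 S x → ∃ λ n → Spelled S (suc n) x
    𝒲⇒spelled (_ , _ , ws@([ _ ]) , x≈w) = _ , respˢ (sym x≈w) (word⇒spelled ws)
    𝒲⇒spelled (_ , _ , ws@(_ ∷ _) , x≈w) = _ , respˢ (sym x≈w) (word⇒spelled ws)

    ⟨⟩⇒spelled : ∀ {x} → ⟨ S ⟩ x → ∃ λ n → Spelled S (suc n) x
    ⟨⟩⇒spelled gx = 𝒲⇒spelled (⟨⟩⇒𝒲 gx)

    spelled-inverse : ∀ {n x} → Spelled S n x → ∃ λ m → Spelled S (suc m) (x ⁻¹)
    spelled-inverse sx = ⟨⟩⇒spelled (inv (spelled⇒⟨⟩ sx))

    spelled-unit : ∃ λ n → Spelled S (suc n) ε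
    spelled-unit = 𝒲⇒spelled 𝒲-ε

  Balanced : Pred Carrier p → Pred Carrier p → Carrier → Carrier → Set (c ⊔ ℓ ⊔ p)
  Balanced S T a b = ∃ λ n → Spelled S n a × Spelled T n b

  module _ {S T : Pred Carrier p} where

    balanced-swap : ∀ {a b} → Balanced S T a b → Balanced T S b a
    balanced-swap (n , sa , sb) = n , sb , sa

    balanced-resp : ∀ {a a' b b'} → a ≈ a' → b ≈ b' → Balanced S T a b → Balanced S T a' b'
    balanced-resp ea eb (n , sa , sb) = n , respˢ ea sa , respˢ eb sb

    balanced-ε : Balanced S T ε ε
    balanced-ε = 0 , []ˢ , []ˢ

    balanced-letters : ∀ {s t} → S s → T t → Balanced S T s t
    balanced-letters Ss Tt = 1 , letterˢ Ss , letterˢ Tt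

    balanced-∙ : ∀ {a a' b b'} → Balanced S T a b → Balanced S T a' b' → Balanced S T (a ∙ a') (b ∙ b')
    balanced-∙ (n , sa , sb) (n' , sa' , sb') = n + n' , sa ++ˢ sa' , sb ++ˢ sb'

  module BalancedSubgroup {S T : Pred Carrier p}
                          (𝒲S-subgroup : IsSubgroup (𝒲 S)) (𝒲T-subgroup : IsSubgroup (𝒲 T)) where
    private
      module 𝒮 = PositiveSpellings 𝒲S-subgroup
      module 𝒯 = PositiveSpellings 𝒲T-subgroup

    -- If x has a spelling as long as some spelling of ε, then (x , ε) is balanced:
    -- pad both sides to a common length with spellings of ε.
    balanced-null : ∀ {A x e} → Spelled S A x → Spelled S A e → e ≈ ε → Balanced S T x ε
    balanced-null {A} sx se e≈ε =
      let q , sε = 𝒯.spelled-unit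
      in suc q * A , padˢ sx se e≈ε q
                   , ≡.subst (λ n → Spelled T n ε) (*-comm A (suc q)) (padˢ []ˢ sε refl A)

    balanced-quotientʳ : ∀ {t u u'} → Spelled S t u → Spelled S t u' → Balanced S T (u ∙ u' ⁻¹) ε
    balanced-quotientʳ {u' = u'} su su' =
      let _ , su'⁻¹ = 𝒮.spelled-inverse su'
      in balanced-null (su ++ˢ su'⁻¹) (su' ++ˢ su'⁻¹) (inverseʳ u')

    balanced-quotientˡ : ∀ {t u u'} → Spelled S t u → Spelled S t u' → Balanced S T (u' ⁻¹ ∙ u) ε
    balanced-quotientˡ {u' = u'} su su' =
      let _ , su'⁻¹ = 𝒮.spelled-inverse su'
      in balanced-null (su'⁻¹ ++ˢ su) (su'⁻¹ ++ˢ su') (inverseˡ u')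

    -- Inverse: pad the spellings of a⁻¹ and b⁻¹ by spellings of a a⁻¹ and b b⁻¹.
    balanced-inverse : ∀ {a b} → Balanced S T a b → Balanced S T (a ⁻¹) (b ⁻¹)
    balanced-inverse {a} {b} (n , sa , sb) =
      let m  , sa⁻¹ = 𝒮.spelled-inverse sa
          m' , sb⁻¹ = 𝒯.spelled-inverse sb
      in suc m + (n + m') * (n + suc m)
       , padˢ sa⁻¹ (sa ++ˢ sa⁻¹) (inverseʳ a) (n + m')
       , ≡.subst (λ k → Spelled T k (b ⁻¹)) (≡.sym (inverse-lengths n m m'))
                 (padˢ sb⁻¹ (sb ++ˢ sb⁻¹) (inverseʳ b) (n + m))

    -- Conjugation: (u x u⁻¹ , y) = (u x u⁻¹ x⁻¹ , ε) · (x , y), and u x u⁻¹ x⁻¹ is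
    -- spelled as long as the null element u x x⁻¹ u⁻¹.
    balanced-conj : ∀ {u x y} → Balanced S T x y → ⟨ S ⟩ u → Balanced S T ((u ∙ x) ∙ u ⁻¹) y
    balanced-conj {u} {x} {y} (n , sx , sy) gu =
      let t  , su   = 𝒮.⟨⟩⇒spelled gu
          t' , su⁻¹ = 𝒮.spelled-inverse su
          m  , sx⁻¹ = 𝒮.spelled-inverse sx
          null = balanced-null (((su ++ˢ sx) ++ˢ su⁻¹) ++ˢ sx⁻¹)
                   (≡.subst (λ k → Spelled S k (((u ∙ x) ∙ x ⁻¹) ∙ u ⁻¹))
                            (swap-last (suc t) n (suc m) (suc t'))
                            (((su ++ˢ sx) ++ˢ sx⁻¹) ++ˢ su⁻¹))
                   (trans (∙-congʳ (//-rightDividesʳ x u)) (inverseʳ u))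
      in balanced-resp (//-rightDividesˡ x _) (identityˡ y) (balanced-∙ null (n , sx , sy))

  module Components (L R : Pred Carrier p)
                    (𝒲L-subgroup : IsSubgroup (𝒲 L)) (𝒲R-subgroup : IsSubgroup (𝒲 R)) where
    open TwoSided L R
    private
      module ℒ  = PositiveSpellings 𝒲L-subgroup
      module ℛ  = PositiveSpellings 𝒲R-subgroup
      module BL = BalancedSubgroup 𝒲L-subgroup 𝒲R-subgroup
      module BR = BalancedSubgroup 𝒲R-subgroup 𝒲L-subgroup

    infix 4 _~_
    _~_ : Carrier → Carrier → Set (c ⊔ ℓ ⊔ p)
    g ~ h = ∃ λ a → ∃ λ b → Balanced L R a b × h ≈ act a b g

    ~-reflexive : ∀ {g h} → g ≈ h → g ~ h
    ~-reflexive {g} g≈h = ε , ε , balanced-ε , trans (sym g≈h) (sym (act-ε g))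

    ~-sym : ∀ {g h} → g ~ h → h ~ g
    ~-sym {g} {h} (a , b , ab , h≈) =
      a ⁻¹ , b ⁻¹ , BL.balanced-inverse ab , trans (sym (act-⁻¹ a b g)) (act-cong refl refl (sym h≈))

    ~-trans : ∀ {g h k} → g ~ h → h ~ k → g ~ k
    ~-trans {g} (a , b , ab , h≈) (a' , b' , ab' , k≈) =
      a ∙ a' , b ∙ b' , balanced-∙ ab ab' ,
      trans k≈ (trans (act-cong refl refl h≈) (sym (act-∙ a a' b b' g)))

    ~-resp : ∀ {g g' h h'} → g ≈ g' → h ≈ h' → g ~ h → g' ~ h'
    ~-resp g≈ h≈ g~h = ~-trans (~-reflexive (sym g≈)) (~-trans g~h (~-reflexive h≈))

    -- ~ is reachability: a path of length n is an act by a balanced pair of length n.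
    reach⇒~ : ∀ {g h} → Reach g h → g ~ h
    reach⇒~ (here g≈h)                       = ~-reflexive g≈h
    reach⇒~ (step (l , r , Ll , Rr , e) path) = ~-trans (l , r , balanced-letters Ll Rr , e) (reach⇒~ path)

    balanced⇒reach : ∀ n {a b g h} → Spelled L n a → Spelled R n b → h ≈ act a b g → Reach g h
    balanced⇒reach zero {g = g} sa sb h≈ =
      here (sym (trans h≈ (trans (act-cong (empty-spelling sa) (empty-spelling sb) refl) (act-ε g))))
    balanced⇒reach (suc n) {g = g} sa sb h≈ =
      let l , a' , Ll , sa' , a≈ = unconsˢ sa
          r , b' , Rr , sb' , b≈ = unconsˢ sb
      in step (l , r , Ll , Rr , refl)
              (balanced⇒reach n sa' sb' (trans h≈ (trans (act-cong a≈ b≈ refl) (act-∙ l a' r b' g))))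

    ~⇒reach : ∀ {g h} → g ~ h → Reach g h
    ~⇒reach (_ , _ , (n , sa , sb) , h≈) = balanced⇒reach n sa sb h≈

    ~⇒sc : ∀ {g h} → g ~ h → StronglyConnected g h
    ~⇒sc g~h = ~⇒reach g~h , ~⇒reach (~-sym g~h)

    sc⇒~ : ∀ {g h} → StronglyConnected g h → g ~ h
    sc⇒~ (path , _) = reach⇒~ path

    -- ~ is invariant under translation by ⟨L⟩ × ⟨R⟩, balanced pairs being
    -- normalised by it (the right side by symmetry of balanced pairs).
    ~-translate : ∀ {x z u v} → x ~ z → ⟨ L ⟩ u → ⟨ R ⟩ v → translate u v x ~ translate u v z
    ~-translate {x} {z} {u} {v} (a , b , ab , z≈) gu gv =
      (u ∙ a) ∙ u ⁻¹ , (v ⁻¹ ∙ b) ∙ v , conjugated ,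
      trans (translate-cong refl refl z≈) (sym (translate-act u v a b x))
      where
      conjugated : Balanced L R ((u ∙ a) ∙ u ⁻¹) ((v ⁻¹ ∙ b) ∙ v)
      conjugated = balanced-swap (balanced-resp (∙-congˡ (⁻¹-involutive v)) refl
                     (BR.balanced-conj (balanced-swap (BL.balanced-conj ab gu)) (inv gv)))

    ~-translateˡ : ∀ {x z u} → x ~ z → ⟨ L ⟩ u → u ∙ x ~ u ∙ z
    ~-translateˡ x~z gu = ~-resp (identityʳ _) (identityʳ _) (~-translate x~z gu unit)

    respellˡ : ∀ {t u u'} → Spelled L t u → Spelled L t u' → ∀ x → u' ∙ x ~ u ∙ x
    respellˡ {u = u} {u'} su su' x =
      u' ∙ u ⁻¹ , ε , BL.balanced-quotientʳ su' su , sym (act-replaceˡ u u' x)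

    respellʳ : ∀ {t v v'} → Spelled R t v → Spelled R t v' → ∀ x → x ∙ v' ~ x ∙ v
    respellʳ {v = v} {v'} sv sv' x =
      ε , v' ⁻¹ ∙ v , balanced-swap (BR.balanced-quotientˡ sv sv') , sym (act-replaceʳ v v' x)

    double-coset-link : ∀ {s x y} → DoubleCoset s x → DoubleCoset s y → DoubleCoset x y
    double-coset-link {s} {x} {y} (a , b , ga , gb , x≈) (a' , b' , ga' , gb' , y≈) =
      a' ∙ a ⁻¹ , b ⁻¹ ∙ b' , mul ga' (inv ga) , mul (inv gb) gb' , (begin
        y                                          ≈⟨ y≈ ⟩
        (a' ∙ s) ∙ b'                              ≈⟨ solve monoid ⟩
        (a' ∙ (ε ∙ s)) ∙ (ε ∙ b')                  ≈⟨ ∙-cong (∙-congˡ (∙-congʳ (inverseˡ a))) (∙-congʳ (inverseʳ b)) ⟨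
        (a' ∙ ((a ⁻¹ ∙ a) ∙ s)) ∙ ((b ∙ b ⁻¹) ∙ b') ≈⟨ solve monoid ⟩
        ((a' ∙ a ⁻¹) ∙ ((a ∙ s) ∙ b)) ∙ (b ⁻¹ ∙ b') ≈⟨ translate-cong refl refl x≈ ⟨
        ((a' ∙ a ⁻¹) ∙ x) ∙ (b ⁻¹ ∙ b')            ∎)

    absorbˡ : ∀ {l x y} → L l → DoubleCoset x y → ∃ λ t → y ~ l ^ t ∙ x
    absorbˡ {l} {x} {y} Ll (a , b , ga , gb , y≈) =
      let m , sb⁻¹ = ℛ.⟨⟩⇒spelled (inv gb)
          w = l ^ suc m
          t , su = ℒ.⟨⟩⇒spelled (mul (inv (spelled⇒⟨⟩ (letter-powerˢ Ll (suc m)))) ga)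
      in suc t ,
         ~-trans (w , b ⁻¹ , (suc m , letter-powerˢ Ll (suc m) , sb⁻¹) ,
                  sym (trans (act-cong refl refl y≈) (act-absorbˡ w a b x)))
                 (respellˡ (letter-powerˢ Ll (suc t)) su x)

    absorbʳ : ∀ {r x y} → R r → DoubleCoset x y → ∃ λ t → y ~ x ∙ r ^ t
    absorbʳ {r} {x} {y} Rr (a , b , ga , gb , y≈) =
      let m , sa = ℒ.⟨⟩⇒spelled ga
          w = r ^ suc m
          t , sv = ℛ.⟨⟩⇒spelled (mul gb (spelled⇒⟨⟩ (letter-powerˢ Rr (suc m))))
      in suc t ,
         ~-trans (a , w , (suc m , sa , letter-powerˢ Rr (suc m)) ,
                  sym (trans (act-cong refl refl y≈) (act-absorbʳ w a b x)))
                 (respellʳ (letter-powerˢ Rr (suc t)) sv x)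

    translate-bijection : ∀ {x y u v} → ⟨ L ⟩ u → ⟨ R ⟩ v → translate u v x ~ y → CompBijection x y
    translate-bijection {x} {y} {u} {v} gu gv ux~y = record
      { to        = λ (g , x-g) → translate u v g ,
                      ~⇒sc (~-trans (~-sym ux~y) (~-translate (sc⇒~ x-g) gu gv))
      ; from      = λ (h , y-h) → translate (u ⁻¹) (v ⁻¹) h ,
                      ~⇒sc (~-resp (translate-⁻¹ u v x) refl
                              (~-trans (~-translate ux~y (inv gu) (inv gv))
                                       (~-translate (sc⇒~ y-h) (inv gu) (inv gv))))
      ; to-cong   = λ _ _ e → translate-cong refl refl e
      ; from-cong = λ _ _ e → translate-cong refl refl e
      ; to-from   = λ (h , _) → translate-⁻¹′ u v h
      ; from-to   = λ (g , _) → translate-⁻¹ u v g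
      }

    same-size : ∀ {x y} → DoubleCoset x y → SameSize x y
    same-size (u , v , gu , gv , y≈) = translate-bijection gu gv (~-reflexive (sym y≈))

    PreservesArcs : Carrier → Carrier → Set (c ⊔ ℓ ⊔ p)
    PreservesArcs u v = ∀ g h → (Arc g h → Arc (translate u v g) (translate u v h))
                              × (Arc (translate u v g) (translate u v h) → Arc g h)

    translate-iso : ∀ {x y u v} → ⟨ L ⟩ u → ⟨ R ⟩ v → PreservesArcs u v →
                    translate u v x ~ y → ComponentsIsomorphic x y
    translate-iso gu gv preserves ux~y =
      translate-bijection gu gv ux~y , λ (g , _) (h , _) → preserves g h

    arc-resp : ∀ {g g' h h'} → g ≈ g' → h ≈ h' → Arc g h → Arc g' h'
    arc-resp g≈ h≈ (l , r , Ll , Rr , h≈lgr) =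
      l , r , Ll , Rr , trans (sym h≈) (trans h≈lgr (act-cong refl refl g≈))

    preserves-resp : ∀ {u u' v v'} → u ≈ u' → v ≈ v' → PreservesArcs u v → PreservesArcs u' v'
    preserves-resp {u} {u'} {v} {v'} u≈ v≈ preserves g h =
      let τ≈ : ∀ z → translate u v z ≈ translate u' v' z
          τ≈ z = translate-cong u≈ v≈ refl
      in (λ a → arc-resp (τ≈ g) (τ≈ h) (proj₁ (preserves g h) a))
       , (λ a → proj₂ (preserves g h) (arc-resp (sym (τ≈ g)) (sym (τ≈ h)) a))

    preserves-ε : PreservesArcs ε ε
    preserves-ε g h =
      let τ≈ : ∀ z → translate ε ε z ≈ z
          τ≈ z = trans (identityʳ _) (identityˡ z)
      in arc-resp (sym (τ≈ g)) (sym (τ≈ h)) , arc-resp (τ≈ g) (τ≈ h)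

    preserves-∘ : ∀ {u v u' v'} → PreservesArcs u v → PreservesArcs u' v' → PreservesArcs (u' ∙ u) (v ∙ v')
    preserves-∘ {u} {v} {u'} {v'} first second g h =
      let τ≈ : ∀ z → translate u' v' (translate u v z) ≈ translate (u' ∙ u) (v ∙ v') z
          τ≈ = translate-∘ u v u' v'
      in (λ a → arc-resp (τ≈ g) (τ≈ h)
                  (proj₁ (second _ _) (proj₁ (first g h) a)))
       , (λ a → proj₂ (first g h) (proj₂ (second _ _) (arc-resp (sym (τ≈ g)) (sym (τ≈ h)) a)))

    preserves-^ : ∀ {u v} → PreservesArcs u v → ∀ j → PreservesArcs (u ^ j) (v ^ j)
    preserves-^ preserves zero    = preserves-ε
    preserves-^ {v = v} preserves (suc j) =
      preserves-resp refl (^-commute v j) (preserves-∘ (preserves-^ preserves j) preserves)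

    normaliserˡ-preserves : ∀ {l₀} → Normalizer L l₀ → PreservesArcs l₀ ε
    normaliserˡ-preserves {l₀} (conj-into , conj-onto) g h =
      (λ (l , r , Ll , Rr , h≈) →
         (l₀ ∙ l) ∙ l₀ ⁻¹ , r , conj-into l Ll , Rr ,
         trans (translate-cong refl refl h≈)
               (trans (sym (translate-act l₀ ε l r g)) (act-cong refl (conj-ε⁻¹ r) refl)))
      , λ (l , r , Ll , Rr , h≈) →
         let x , Lx , l≈ = conj-onto l Ll
         in x , r , Lx , Rr ,
            translate-injective (trans h≈ (trans (act-cong l≈ (sym (conj-ε⁻¹ r)) refl)
                                                 (translate-act l₀ ε x r g)))

    normaliserʳ-preserves : ∀ {r₀} → Normalizer R r₀ → PreservesArcs ε r₀
    normaliserʳ-preserves {r₀} (conj-into , conj-onto) g h =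
      (λ (l , r , Ll , Rr , h≈) →
         let x , Rx , r≈ = conj-onto r Rr
         in l , x , Ll , Rx ,
            trans (translate-cong refl refl h≈)
                  (trans (sym (translate-act ε r₀ l r g))
                         (act-cong (conj-ε l) (trans (translate-cong refl refl r≈) (conj-cancel r₀ x)) refl)))
      , λ (l , r , Ll , Rr , h≈) →
         l , (r₀ ∙ r) ∙ r₀ ⁻¹ , Ll , conj-into r Rr ,
         translate-injective (trans h≈ (trans (act-cong (sym (conj-ε l)) (sym (conj-cancel r₀ r)) refl)
                                              (translate-act ε r₀ l _ g)))

    -- With l₀ ∈ L ∩ N_G(L): y ~ l₀ᵗ x, and translation by l₀ᵗ preserves arcs.
    isomorphicˡ : ∀ {l₀ x y} → L l₀ → Normalizer L l₀ → DoubleCoset x y → ComponentsIsomorphic x y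
    isomorphicˡ Ll₀ N dxy =
      let t , y~ = absorbˡ Ll₀ dxy
      in translate-iso (spelled⇒⟨⟩ (letter-powerˢ Ll₀ t)) unit
           (preserves-resp refl (ε^n≈ε t) (preserves-^ (normaliserˡ-preserves N) t))
           (~-resp (sym (identityʳ _)) refl (~-sym y~))

    -- With r₀ ∈ R ∩ N_G(R): y ~ x r₀ᵗ, and translation by r₀ᵗ preserves arcs.
    isomorphicʳ : ∀ {r₀ x y} → R r₀ → Normalizer R r₀ → DoubleCoset x y → ComponentsIsomorphic x y
    isomorphicʳ Rr₀ N dxy =
      let t , y~ = absorbʳ Rr₀ dxy
      in translate-iso unit (spelled⇒⟨⟩ (letter-powerˢ Rr₀ t))
           (preserves-resp (ε^n≈ε t) refl (preserves-^ (normaliserʳ-preserves N) t))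
           (~-resp (sym (∙-congʳ (identityˡ _))) refl (~-sym y~))

    return⇒conn-word : ∀ {l s} → L l → ∀ n → s ~ l ^ suc n ∙ s → HasConnWord s (suc n)
    return⇒conn-word Ll n s~ =
      let w , ws , w≈ = letter-power-word Ll n
      in w , inj₁ ws , ~⇒sc (~-resp (∙-congʳ (sym w≈)) refl (~-sym s~))

    conn-word⇒return : ∀ {l s k} → L l → HasConnWord s k → l ^ k ∙ s ~ s
    conn-word⇒return {s = s} {k} Ll (w , inj₁ ws , ws-s) =
      ~-trans (respellˡ (word⇒spelled ws) (letter-powerˢ Ll k) s) (sc⇒~ ws-s)
    conn-word⇒return {s = s} {k} Ll (w , inj₂ ws , ws-s) =
      ~-trans (respellˡ sw⁻¹ (letter-powerˢ Ll k) s)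
              (~-sym (~-resp (\\-leftDividesʳ w s) refl (~-translateˡ (sc⇒~ ws-s) (spelled⇒⟨⟩ sw⁻¹))))
      where sw⁻¹ = inverse-word⇒spelled ws

    -- A connecting word always exists, since ε ∈ 𝒲(L): k_s is finite.
    conn-word-exists : ∀ s → ∃ λ n → 1 ≤ n × HasConnWord s n
    conn-word-exists s =
      let n , w , ws , ε≈w = proj₁ 𝒲L-subgroup
      in n , word-length-positive ws , w , inj₁ ws ,
         ~⇒sc (~-reflexive (trans (∙-congʳ (sym ε≈w)) (identityˡ s)))

    shift : ∀ {l s k} → L l → l ^ k ∙ s ~ s → ∀ a q → l ^ (a + q * k) ∙ s ~ l ^ a ∙ s
    shift {l} Ll per a zero = ~-reflexive (∙-congʳ (reflexive (≡.cong (l ^_) (+-identityʳ a))))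
    shift {l} {s} {k} Ll per a (suc q) =
      ~-trans (~-resp exponent refl (~-translateˡ per (spelled⇒⟨⟩ (letter-powerˢ Ll (a + q * k)))))
              (shift Ll per a q)
      where
      exponent : l ^ (a + q * k) ∙ (l ^ k ∙ s) ≈ l ^ (a + (k + q * k)) ∙ s
      exponent = begin
        l ^ (a + q * k) ∙ (l ^ k ∙ s)   ≈⟨ assoc _ _ _ ⟨
        (l ^ (a + q * k) ∙ l ^ k) ∙ s   ≈⟨ ∙-congʳ (^-+ l (a + q * k) k) ⟨
        l ^ ((a + q * k) + k) ∙ s       ≈⟨ ∙-congʳ (reflexive (≡.cong (l ^_) (add-period a q k))) ⟨
        l ^ (a + (k + q * k)) ∙ s       ∎

    -- By minimality of k, the representatives lᵃ s, a < k, are pairwise unrelated: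
    -- lᵃ s ~ lᵃ⁺ᵒ⁺¹ s would give the shorter connecting word lᵒ⁺¹.
    representatives-separated : ∀ {l s k} → L l → (∀ m → 1 ≤ m → m < k → ¬ HasConnWord s m) →
                                ∀ {a b} → a < b → b < k → ¬ (l ^ a ∙ s ~ l ^ b ∙ s)
    representatives-separated {l} {s} Ll minimal {a} a<b b<k lᵃs~lᵇs
      with m≤n⇒∃[o]m+o≡n a<b
    ... | o , ≡.refl =
      minimal (suc o) (s≤s z≤n) (≤-trans (s≤s (s≤s (m≤n+m o a))) b<k)
        (return⇒conn-word Ll o
          (~-resp (\\-leftDividesʳ (l ^ a) s) cancel (~-translateˡ lᵃs~lᵇs (inv (spelled⇒⟨⟩ (letter-powerˢ Ll a))))))
      where
      cancel : (l ^ a) ⁻¹ ∙ (l ^ (suc a + o) ∙ s) ≈ l ^ suc o ∙ s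
      cancel = begin
        (l ^ a) ⁻¹ ∙ (l ^ (suc a + o) ∙ s)        ≈⟨ ∙-congˡ (∙-congʳ (reflexive (≡.cong (l ^_) (+-suc a o)))) ⟨
        (l ^ a) ⁻¹ ∙ (l ^ (a + suc o) ∙ s)        ≈⟨ ∙-congˡ (∙-congʳ (^-+ l a (suc o))) ⟩
        (l ^ a) ⁻¹ ∙ ((l ^ a ∙ l ^ suc o) ∙ s)    ≈⟨ ∙-congˡ (assoc _ _ _) ⟩
        (l ^ a) ⁻¹ ∙ (l ^ a ∙ (l ^ suc o ∙ s))    ≈⟨ \\-leftDividesʳ (l ^ a) _ ⟩
        l ^ suc o ∙ s                             ∎

    -- With k = k_s and l ∈ L, the elements l⁰s, …, lᵏ⁻¹s represent the components:
    -- every element is ~ lᵗs ~ l^(t mod k)s, and they are pairwise unrelated.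
    exactly-k-components : ∀ {l s k} → L l → IsMinConnLength s k → ExactlyComponents s k
    exactly-k-components {k = zero} _ (() , _)
    exactly-k-components {l} {s} {suc k′} Ll (_ , conn , minimal) = rep , rep-in-coset , covered , distinct
      where
      k = suc k′

      rep : Fin k → Carrier
      rep i = l ^ toℕ i ∙ s

      rep-in-coset : ∀ i → DoubleCoset s (rep i)
      rep-in-coset i = l ^ toℕ i , ε , spelled⇒⟨⟩ (letter-powerˢ Ll (toℕ i)) , unit , sym (identityʳ _)

      exponent : ∀ {m n} → m ≡ n → l ^ m ∙ s ≈ l ^ n ∙ s
      exponent m≡n = ∙-congʳ (reflexive (≡.cong (l ^_) m≡n))

      reduce : ∀ t → l ^ t ∙ s ~ rep (fromℕ< (m%n<n t k))
      reduce t = ~-resp (exponent (≡.sym (m≡m%n+[m/n]*n t k))) (exponent (≡.sym (toℕ-fromℕ< (m%n<n t k))))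
                        (shift Ll (conn-word⇒return Ll conn) (t % k) (t / k))

      covered : ∀ g → DoubleCoset s g → ∃ λ i → StronglyConnected g (rep i)
      covered g dg = let t , g~ = absorbˡ Ll dg in fromℕ< (m%n<n t k) , ~⇒sc (~-trans g~ (reduce t))

      distinct : ∀ i j → StronglyConnected (rep i) (rep j) → i ≡ j
      distinct i j sc with <-cmp (toℕ i) (toℕ j)
      ... | tri< i<j _ _ = ⊥-elim (representatives-separated Ll minimal i<j (toℕ<n j) (sc⇒~ sc))
      ... | tri≈ _ i≡j _ = toℕ-injective i≡j
      ... | tri> _ _ j<i = ⊥-elim (representatives-separated Ll minimal j<i (toℕ<n i) (~-sym (sc⇒~ sc)))

theorem4p12 : ∀ {c ℓ p : Level} (G : Group c ℓ) → let open Group G using (Carrier) in let open GroupDigraph G in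
  (L R : Pred Carrier p) → Respects≈ L → Respects≈ R →
  NonEmpty L → NonEmpty R → IsSubgroup (𝒲 L) → IsSubgroup (𝒲 R) →
  (s : Carrier) → let open TwoSided L R in
    ((k : ℕ) → IsMinConnLength s k → ExactlyComponents s k)
    × (InfiniteConnLength s → InfinitelyManyComponents s)
    × (∀ x y → DoubleCoset s x → DoubleCoset s y → SameSize x y)
    × ((∃ λ l → L l × Normalizer L l) ⊎ (∃ λ r → R r × Normalizer R r) →
         ∀ x y → DoubleCoset s x → DoubleCoset s y → ComponentsIsomorphic x y)
theorem4p12 {p = p} G L R _ _ (l , Ll) _ 𝒲L-subgroup 𝒲R-subgroup s =
    (λ k minimal → exactly-k-components Ll minimal)
  , (λ infinite → let n , 1≤n , conn = conn-word-exists s in ⊥-elim (infinite n 1≤n conn))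
  , (λ x y dx dy → same-size (double-coset-link dx dy))
  , λ { (inj₁ (l₀ , Ll₀ , N)) x y dx dy → isomorphicˡ Ll₀ N (double-coset-link dx dy)
      ; (inj₂ (r₀ , Rr₀ , N)) x y dx dy → isomorphicʳ Rr₀ N (double-coset-link dx dy) }
  where
  open TwoSidedComponents {p = p} G
  open Components L R 𝒲L-subgroup 𝒲R-subgroup
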